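{- Let $k\in\mathbb N^+$. If a digraph $D$ has more than $(k-1)|V(D)|$ edges, then $D$ contains a subdigraph $D'$ with $\bar\delta^0(D')\ge\frac k2$.
   Context: For a digraph $D$ with at least one edge, the minimum pseudo-semidegree $\bar\delta^0(D)$ is the largest $d$ such that for every vertex $v\in V(D)$ both its out-degree and its in-degree lie in $\{0\}\cup[d,\infty)$; equivalently, it is the minimum of all nonzero values among the in-degrees and out-degrees of the vertices of $D$. For a digraph with no edges, $\bar\delta^0(D)=0$. -}

module Defs where

open import Data.Nat using (ℕ; zero; suc; _+_; _⊓_)
open import Data.Bool using (Bool; true; false; if_then_else_)
open import Data.Fin using (Fin)
open import Data.List using (List; map; foldr; allFin)
open import Data.Nat.ListAction using (sum)
open import Relation.Binary.PropositionalEquality using (_≡_)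

-- A (simple, loopless) digraph on the vertex set Fin n:
-- adj u v ≡ true  iff  (u , v) is an arc.  Opposite arcs u→v, v→u may both exist.
record Digraph (n : ℕ) : Set where
  field
    adj     : Fin n → Fin n → Bool
    noLoops : ∀ v → adj v v ≡ false
open Digraph public

count : ∀ {n} → (Fin n → Bool) → ℕ
count {n} p = sum (map (λ u → if p u then 1 else 0) (allFin n))

edges : ∀ {n} → Digraph n → ℕ
edges {n} D = sum (map (λ v → count (adj D v)) (allFin n))

outdeg indeg : ∀ {n} → Digraph n → Fin n → ℕ
outdeg D v = count (λ u → adj D v u)
indeg  D v = count (λ u → adj D u v)

-- minimum of nonzero values, where 0 plays the role of "no value yet"
minNZ : ℕ → ℕ → ℕ
minNZ zero b = b
minNZ (suc a) zero = suc a
minNZ (suc a) (suc b) = suc a ⊓ suc b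

record Subdigraph {n : ℕ} (D : Digraph n) : Set where
  field
    inV    : Fin n → Bool
    arc    : Fin n → Fin n → Bool
    arc⊆   : ∀ u v → arc u v ≡ true → adj D u v ≡ true
    arcSrc : ∀ u v → arc u v ≡ true → inV u ≡ true
    arcTgt : ∀ u v → arc u v ≡ true → inV v ≡ true
open Subdigraph public

-- the subdigraph viewed as a digraph on Fin n (vertices outside inV have
-- in- and out-degree 0, so they do not affect the pseudo-semidegree)
asDigraph : ∀ {n} {D : Digraph n} → Subdigraph D → Digraph n
asDigraph {D = D} S = record
  { adj = arc S
  ; noLoops = λ v → helper v (arc S v v) (arc⊆ S v v)
  }
  where
  helper : ∀ v (b : Bool) → (b ≡ true → adj D v v ≡ true) → b ≡ false
  helper v false _ = Relation.Binary.PropositionalEquality.refl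
  helper v true  h with Relation.Binary.PropositionalEquality.trans
                          (Relation.Binary.PropositionalEquality.sym (h Relation.Binary.PropositionalEquality.refl))
                          (noLoops D v)
  ... | ()

-- minimum pseudo-semidegree: the minimum of all nonzero in-/out-degrees
-- of vertices, and 0 if the digraph has no arcs.
minPseudoSemidegree : ∀ {n} → Digraph n → ℕ
minPseudoSemidegree {n} D =
  foldr (λ v acc → minNZ (outdeg D v) (minNZ (indeg D v) acc)) 0 (allFin n)

{-# OPTIONS --safe #-}

-- Let c = ⌊(k − 1)/2⌋ and call an arc set F dense when c (t + h) < |F|, where t and h
-- count the vertices of positive out- and in-degree. Since t, h ≤ n and 2c ≤ k − 1, the
-- hypothesis makes D itself dense. As long as some vertex has out-degree between 1 and c, delete its out-arcs:
-- at most c arcs disappear, t drops by one and h does not grow, so density survives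
-- (in-degrees are handled the same way in the transposed arc set). Arcs strictly decrease,
-- so the process stops at a dense, hence nonempty, arc set whose nonzero in- and
-- out-degrees are all at least c + 1 ≥ k/2.

module Submission where

open import Defs
open import Data.Nat using (ℕ; zero; suc; _+_; _∸_; _*_; _≤_; _<_; _>_; _≥_; z≤n; s≤s;
  _≤?_; _<?_; ⌊_/2⌋; ⌈_/2⌉)
open import Data.Nat.Induction using (<-wellFounded)
open import Data.Nat.ListAction as List using ()
open import Data.Nat.Properties hiding (_≟_)
open import Data.Bool using (Bool; true; false; if_then_else_)
open import Data.Fin using (Fin; zero; suc; _≟_; punchIn)
open import Data.Fin.Properties using (any?; punchInᵢ≢i)
open import Data.List using (List; []; _∷_; map; foldr; allFin; tabulate)
open import Data.List.Membership.Propositional using (_∈_)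
open import Data.List.Membership.Propositional.Properties using (∈-allFin)
open import Data.List.Relation.Unary.Any using (here; there)
open import Data.Product using (Σ; Σ-syntax; ∃; _×_; _,_; proj₁; proj₂)
open import Data.Sum using (_⊎_; inj₁; inj₂)
open import Data.Vec.Functional using (removeAt)
open import Function using (_∘_; id)
open import Induction.WellFounded using (module All)
open import Level using (0ℓ)
open import Relation.Binary.Construct.On as On using ()
open import Relation.Binary.PropositionalEquality
open import Relation.Nullary using (¬_; Dec; yes; no; does; contradiction)
open import Relation.Nullary.Decidable using (_×-dec_)

open import Algebra.Properties.CommutativeSemigroup +-commutativeSemigroup using (x∙yz≈y∙xz)
open import Algebra.Properties.CommutativeMonoid.Sum +-0-commutativeMonoid
  using (sum; sum-cong-≗; sum-remove; sum-replicate-zero; ∑-comm)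

private
  variable
    n c d : ℕ

sum-mono-≤ : {f g : Fin n → ℕ} → (∀ i → f i ≤ g i) → sum f ≤ sum g
sum-mono-≤ {zero}  f≤g = z≤n
sum-mono-≤ {suc n} f≤g = +-mono-≤ (f≤g zero) (sum-mono-≤ (f≤g ∘ suc))

sum-≤-* : ∀ {m} {f : Fin n → ℕ} → (∀ i → f i ≤ m) → sum f ≤ n * m
sum-≤-* {zero}  f≤m = z≤n
sum-≤-* {suc n} f≤m = +-mono-≤ (f≤m zero) (sum-≤-* (f≤m ∘ suc))

sum-positive : (f : Fin n → ℕ) → 0 < sum f → ∃ λ i → 0 < f i
sum-positive {suc n} f 0<∑f with f zero in eq
... | suc _ = zero , subst (0 <_) (sym eq) (s≤s z≤n)
... | zero  with sum-positive (f ∘ suc) 0<∑f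
...   | i , 0<fi = suc i , 0<fi

sum-agreeOff : (i : Fin n) {f g : Fin n → ℕ} → (∀ j → j ≢ i → f j ≡ g j) →
               f i + sum g ≡ g i + sum f
sum-agreeOff {suc n} i {f} {g} f≡g = begin
  f i + sum g                         ≡⟨ cong (f i +_) (sum-remove {i = i} g) ⟩
  f i + (g i + sum (removeAt g i))    ≡⟨ x∙yz≈y∙xz (f i) (g i) _ ⟩
  g i + (f i + sum (removeAt g i))    ≡⟨ cong (λ s → g i + (f i + s)) (sum-cong-≗ agree) ⟨
  g i + (f i + sum (removeAt f i))    ≡⟨ cong (g i +_) (sum-remove {i = i} f) ⟨
  g i + sum f                         ∎
  where
  open ≡-Reasoning
  agree : ∀ j → f (punchIn i j) ≡ g (punchIn i j)
  agree j = f≡g (punchIn i j) (punchInᵢ≢i i j)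

sum-map-tabulate : ∀ (f : Fin n → ℕ) {m} (g : Fin m → Fin n) →
                   List.sum (map f (tabulate g)) ≡ sum (f ∘ g)
sum-map-tabulate f {zero}  g = refl
sum-map-tabulate f {suc m} g = cong (f (g zero) +_) (sum-map-tabulate f (g ∘ suc))

ind : Bool → ℕ
ind b = if b then 1 else 0

ind-mono : ∀ {a b} → (a ≡ true → b ≡ true) → ind a ≤ ind b
ind-mono {false} a⇒b = z≤n
ind-mono {true}  a⇒b rewrite a⇒b refl = ≤-refl

count≡sum : (p : Fin n → Bool) → count p ≡ sum (ind ∘ p)
count≡sum p = sum-map-tabulate (ind ∘ p) id

sign : ℕ → ℕ
sign zero    = 0
sign (suc _) = 1

sign-mono : ∀ {a b} → a ≤ b → sign a ≤ sign b
sign-mono {zero}  _       = z≤n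
sign-mono {suc a} (s≤s _) = ≤-refl

sign≤1 : ∀ a → sign a ≤ 1
sign≤1 zero    = z≤n
sign≤1 (suc a) = ≤-refl

Arcs : ℕ → Set
Arcs n = Fin n → Fin n → Bool

_⊆_ : Arcs n → Arcs n → Set
F ⊆ G = ∀ u w → F u w ≡ true → G u w ≡ true

transpose : Arcs n → Arcs n
transpose F u w = F w u

outdegree indegree : Arcs n → Fin n → ℕ
outdegree F u = sum (λ w → ind (F u w))
indegree F = outdegree (transpose F)

size : Arcs n → ℕ
size F = sum (outdegree F)

#tails #heads : Arcs n → ℕ
#tails F = sum (sign ∘ outdegree F)
#heads F = #tails (transpose F)

deleteOutArcs : Arcs n → Fin n → Arcs n
deleteOutArcs F v u w = if does (u ≟ v) then false else F u w

size-transpose : (F : Arcs n) → size (transpose F) ≡ size F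
size-transpose F = ∑-comm (λ u w → ind (F w u))

outdegree-mono : {F G : Arcs n} → F ⊆ G → ∀ u → outdegree F u ≤ outdegree G u
outdegree-mono F⊆G u = sum-mono-≤ (λ w → ind-mono (F⊆G u w))

#tails-mono : {F G : Arcs n} → F ⊆ G → #tails F ≤ #tails G
#tails-mono F⊆G = sum-mono-≤ (sign-mono ∘ outdegree-mono F⊆G)

#tails≤n : (F : Arcs n) → #tails F ≤ n
#tails≤n {n} F = ≤-trans (sum-≤-* (sign≤1 ∘ outdegree F)) (≤-reflexive (*-identityʳ n))

deleteOutArcs-⊆ : (F : Arcs n) (v : Fin n) → deleteOutArcs F v ⊆ F
deleteOutArcs-⊆ F v u w p with u ≟ v
... | no _ = p

outdegree-deleteOutArcs-self : (F : Arcs n) (v : Fin n) → outdegree (deleteOutArcs F v) v ≡ 0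
outdegree-deleteOutArcs-self {n} F v with v ≟ v
... | yes _  = sum-replicate-zero n
... | no v≢v = contradiction refl v≢v

outdegree-deleteOutArcs-other : (F : Arcs n) {u v : Fin n} → u ≢ v →
                                outdegree (deleteOutArcs F v) u ≡ outdegree F u
outdegree-deleteOutArcs-other F {u} {v} u≢v with u ≟ v
... | no _    = refl
... | yes u≡v = contradiction u≡v u≢v

size-deleteOutArcs : (F : Arcs n) (v : Fin n) →
                     outdegree F v + size (deleteOutArcs F v) ≡ size F
size-deleteOutArcs F v =
  trans (sum-agreeOff v (λ u u≢v → sym (outdegree-deleteOutArcs-other F u≢v)))
        (cong (_+ size F) (outdegree-deleteOutArcs-self F v))

sign-positive : ∀ {a} → 0 < a → sign a ≡ 1
sign-positive {suc a} _ = refl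

#tails-deleteOutArcs : (F : Arcs n) (v : Fin n) → 0 < outdegree F v →
                       suc (#tails (deleteOutArcs F v)) ≡ #tails F
#tails-deleteOutArcs F v 0<out = begin
  suc (#tails F′)                          ≡⟨ cong (_+ #tails F′) (sign-positive 0<out) ⟨
  sign (outdegree F v) + #tails F′         ≡⟨ sum-agreeOff v (λ u u≢v → cong sign (sym (outdegree-deleteOutArcs-other F u≢v))) ⟩
  sign (outdegree F′ v) + #tails F         ≡⟨ cong (λ a → sign a + #tails F) (outdegree-deleteOutArcs-self F v) ⟩
  #tails F                                 ∎
  where
  open ≡-Reasoning
  F′ : Arcs _
  F′ = deleteOutArcs F v

LowOut : ℕ → Arcs n → Fin n → Set
LowOut c F v = 0 < outdegree F v × outdegree F v ≤ c

Dense : ℕ → Arcs n → Set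
Dense c F = c * (#tails F + #heads F) < size F

Dense-transpose : (F : Arcs n) → Dense c F → Dense c (transpose F)
Dense-transpose {c = c} F =
  subst₂ (λ t s → c * t < s) (+-comm (#tails F) (#heads F)) (sym (size-transpose F))

Dense-deleteOutArcs : (F : Arcs n) (v : Fin n) → LowOut c F v → Dense c F →
                      Dense c (deleteOutArcs F v)
Dense-deleteOutArcs {c = c} F v (0<out , out≤c) dense = +-cancelˡ-≤ (outdegree F v) _ _ (begin
  outdegree F v + suc (c * (t′ + h′))  ≤⟨ +-mono-≤ out≤c (s≤s (*-monoʳ-≤ c (+-monoʳ-≤ t′ h′≤h))) ⟩
  c + suc (c * (t′ + h))               ≡⟨ +-suc c _ ⟩
  suc (c + c * (t′ + h))               ≡⟨ cong suc (*-suc c (t′ + h)) ⟨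
  suc (c * (suc t′ + h))               ≡⟨ cong (λ t → suc (c * (t + h))) (#tails-deleteOutArcs F v 0<out) ⟩
  suc (c * (#tails F + h))             ≤⟨ dense ⟩
  size F                               ≡⟨ size-deleteOutArcs F v ⟨
  outdegree F v + size F′              ∎)
  where
  open ≤-Reasoning
  F′ : Arcs _
  F′ = deleteOutArcs F v
  t′ h′ h : ℕ
  t′ = #tails F′
  h′ = #heads F′
  h  = #heads F
  h′≤h : h′ ≤ h
  h′≤h = #tails-mono (λ u w → deleteOutArcs-⊆ F v w u)

lowOut? : ∀ c (F : Arcs n) → Dec (∃ (LowOut c F))
lowOut? c F = any? λ v → (0 <? outdegree F v) ×-dec (outdegree F v ≤? c)

SmallerDense : ℕ → Arcs n → Set
SmallerDense {n} c F = Σ[ G ∈ Arcs n ] G ⊆ F × size G < size F × Dense c G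

deleteLowOut : (F : Arcs n) → Dense c F → ∀ {v} → LowOut c F v → SmallerDense c F
deleteLowOut F dense {v} low@(0<out , _) =
  deleteOutArcs F v ,
  deleteOutArcs-⊆ F v ,
  ≤-trans (+-monoˡ-≤ _ 0<out) (≤-reflexive (size-deleteOutArcs F v)) ,
  Dense-deleteOutArcs F v low dense

SmallerDense-transpose : (F : Arcs n) → SmallerDense c (transpose F) → SmallerDense c F
SmallerDense-transpose {c = c} F (G , G⊆Fᵀ , G<Fᵀ , dense) =
  transpose G ,
  (λ u w → G⊆Fᵀ w u) ,
  subst₂ _<_ (sym (size-transpose G)) (size-transpose F) G<Fᵀ ,
  Dense-transpose {c = c} G dense

ZeroOrAtLeast : ℕ → ℕ → Set
ZeroOrAtLeast d m = m ≡ 0 ⊎ d ≤ m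

ZeroOrAtLeast-positive : ∀ {m} → ZeroOrAtLeast d m → 0 < m → d ≤ m
ZeroOrAtLeast-positive (inj₁ refl) ()
ZeroOrAtLeast-positive (inj₂ d≤m) _ = d≤m

¬low⇒ZeroOrAtLeast : ∀ {m} → ¬ (0 < m × m ≤ c) → ZeroOrAtLeast (suc c) m
¬low⇒ZeroOrAtLeast {m = zero}  ¬low = inj₁ refl
¬low⇒ZeroOrAtLeast {c} {suc m} ¬low with suc m ≤? c
... | yes m<c = contradiction (s≤s z≤n , m<c) ¬low
... | no  m≮c = inj₂ (≰⇒> m≮c)

PseudoSemidegree≥ : ℕ → Arcs n → Set
PseudoSemidegree≥ d F = ∀ v → ZeroOrAtLeast d (outdegree F v) × ZeroOrAtLeast d (indegree F v)

Pruning : ℕ → Arcs n → Set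
Pruning {n} c F = Σ[ G ∈ Arcs n ] G ⊆ F × 0 < size G × PseudoSemidegree≥ (suc c) G

prune : ∀ c (F : Arcs n) → Dense c F → Pruning c F
prune {n} c = All.wfRec (On.wellFounded size <-wellFounded) 0ℓ (λ F → Dense c F → Pruning c F) step
  where
  Recursion : Arcs n → Set
  Recursion F = ∀ {G} → size G < size F → Dense c G → Pruning c G

  recurse : ∀ {F} → Recursion F → SmallerDense c F → Pruning c F
  recurse rec (G , G⊆F , G<F , denseG) with rec G<F denseG
  ... | H , H⊆G , pruned = H , (λ u w → G⊆F u w ∘ H⊆G u w) , pruned

  step : ∀ F → Recursion F → Dense c F → Pruning c F
  step F rec dense with lowOut? c F | lowOut? c (transpose F)
  ... | yes (_ , low) | _             = recurse rec (deleteLowOut F dense low)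
  ... | no _          | yes (_ , low) =
    recurse rec (SmallerDense-transpose {c = c} F
                  (deleteLowOut (transpose F) (Dense-transpose {c = c} F dense) low))
  ... | no ¬lowOut    | no ¬lowIn     =
    F , (λ _ _ p → p) , ≤-trans (s≤s z≤n) dense ,
    λ v → ¬low⇒ZeroOrAtLeast (¬lowOut ∘ (v ,_)) , ¬low⇒ZeroOrAtLeast (¬lowIn ∘ (v ,_))

minNZ-ZeroOrAtLeast : ∀ {a b} → ZeroOrAtLeast d a → ZeroOrAtLeast d b → ZeroOrAtLeast d (minNZ a b)
minNZ-ZeroOrAtLeast {a = zero}          _          zb         = zb
minNZ-ZeroOrAtLeast {a = suc a} {zero}  za         _          = za
minNZ-ZeroOrAtLeast {a = suc a} {suc b} (inj₂ d≤a) (inj₂ d≤b) = inj₂ (⊓-glb d≤a d≤b)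

minNZ-positiveˡ : ∀ {a} b → 0 < a → 0 < minNZ a b
minNZ-positiveˡ {suc a} zero    _ = s≤s z≤n
minNZ-positiveˡ {suc a} (suc b) _ = s≤s z≤n

minNZ-positiveʳ : ∀ a {b} → 0 < b → 0 < minNZ a b
minNZ-positiveʳ zero            0<b = 0<b
minNZ-positiveʳ (suc a) {suc b} _   = s≤s z≤n

foldMinNZ : (Fin n → ℕ) → (Fin n → ℕ) → List (Fin n) → ℕ
foldMinNZ O I = foldr (λ v acc → minNZ (O v) (minNZ (I v) acc)) 0

foldMinNZ-ZeroOrAtLeast : {O I : Fin n → ℕ} →
                          (∀ v → ZeroOrAtLeast d (O v) × ZeroOrAtLeast d (I v)) →
                          ∀ xs → ZeroOrAtLeast d (foldMinNZ O I xs)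
foldMinNZ-ZeroOrAtLeast bounded []       = inj₁ refl
foldMinNZ-ZeroOrAtLeast bounded (v ∷ xs) =
  minNZ-ZeroOrAtLeast (proj₁ (bounded v))
    (minNZ-ZeroOrAtLeast (proj₂ (bounded v)) (foldMinNZ-ZeroOrAtLeast bounded xs))

foldMinNZ-positive : {O I : Fin n → ℕ} {v : Fin n} {xs : List (Fin n)} →
                     v ∈ xs → 0 < O v → 0 < foldMinNZ O I xs
foldMinNZ-positive         (here refl) 0<Ov = minNZ-positiveˡ _ 0<Ov
foldMinNZ-positive {O = O} {I} (there {x = x} v∈xs) 0<Ov =
  minNZ-positiveʳ (O x) (minNZ-positiveʳ (I x) (foldMinNZ-positive {O = O} {I} v∈xs 0<Ov))

minPseudoSemidegree-≥ : (H : Digraph n) →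
                        (∀ v → ZeroOrAtLeast d (outdeg H v) × ZeroOrAtLeast d (indeg H v)) →
                        ∀ v → 0 < outdeg H v → d ≤ minPseudoSemidegree H
minPseudoSemidegree-≥ {n} H bounded v 0<out =
  ZeroOrAtLeast-positive (foldMinNZ-ZeroOrAtLeast bounded (allFin n))
                         (foldMinNZ-positive {O = outdeg H} {indeg H} (∈-allFin v) 0<out)

edges≡size : (D : Digraph n) → edges D ≡ size (adj D)
edges≡size D = trans (sum-map-tabulate (count ∘ adj D) id)
                     (sum-cong-≗ (count≡sum ∘ adj D))

spanning : (D : Digraph n) (G : Arcs n) → G ⊆ adj D → Subdigraph D
spanning D G G⊆D = record
  { inV    = λ _ → true
  ; arc    = G
  ; arc⊆   = G⊆D
  ; arcSrc = λ _ _ _ → refl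
  ; arcTgt = λ _ _ _ → refl
  }

minPseudoSemidegree-spanning : (D : Digraph n) (G : Arcs n) (G⊆D : G ⊆ adj D) →
                               PseudoSemidegree≥ d G → 0 < size G →
                               d ≤ minPseudoSemidegree (asDigraph (spanning D G G⊆D))
minPseudoSemidegree-spanning {d = d} D G G⊆D bounded 0<size
  with sum-positive (outdegree G) 0<size
... | v , 0<out = minPseudoSemidegree-≥ (asDigraph (spanning D G G⊆D)) bounded′ v
                    (subst (0 <_) (sym (count≡sum (G v))) 0<out)
  where
  bounded′ : ∀ u → ZeroOrAtLeast d (count (G u)) × ZeroOrAtLeast d (count (λ w → G w u))
  bounded′ u = subst (ZeroOrAtLeast d) (sym (count≡sum (G u))) (proj₁ (bounded u)) ,
               subst (ZeroOrAtLeast d) (sym (count≡sum (λ w → G w u))) (proj₂ (bounded u))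

Dense-many-arcs : ∀ {m} (F : Arcs n) → c + c ≤ m → m * n < size F → Dense c F
Dense-many-arcs {n} {c} {m} F c+c≤m many = begin-strict
  c * (#tails F + #heads F)  ≤⟨ *-monoʳ-≤ c (+-mono-≤ (#tails≤n F) (#tails≤n (transpose F))) ⟩
  c * (n + n)                ≡⟨ *-distribˡ-+ c n n ⟩
  c * n + c * n              ≡⟨ *-distribʳ-+ n c c ⟨
  (c + c) * n                ≤⟨ *-monoˡ-≤ n c+c≤m ⟩
  m * n                      <⟨ many ⟩
  size F                     ∎
  where open ≤-Reasoning

⌊n/2⌋+⌊n/2⌋≤n : ∀ n → ⌊ n /2⌋ + ⌊ n /2⌋ ≤ n
⌊n/2⌋+⌊n/2⌋≤n n = ≤-trans (+-monoʳ-≤ ⌊ n /2⌋ (⌊n/2⌋≤⌈n/2⌉ n)) (≤-reflexive (⌊n/2⌋+⌈n/2⌉≡n n))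

n≤2*⌈n/2⌉ : ∀ n → n ≤ 2 * ⌈ n /2⌉
n≤2*⌈n/2⌉ n = begin
  n                          ≡⟨ ⌊n/2⌋+⌈n/2⌉≡n n ⟨
  ⌊ n /2⌋ + ⌈ n /2⌉          ≤⟨ +-monoˡ-≤ ⌈ n /2⌉ (⌊n/2⌋≤⌈n/2⌉ n) ⟩
  ⌈ n /2⌉ + ⌈ n /2⌉          ≡⟨ cong (⌈ n /2⌉ +_) (+-identityʳ ⌈ n /2⌉) ⟨
  2 * ⌈ n /2⌉                ∎
  where open ≤-Reasoning

lemma9 : (k n : ℕ) → k > 0 → (D : Digraph n) →
    edges D > (k ∸ 1) * n →
    Σ (Subdigraph D) (λ D′ → 2 * minPseudoSemidegree (asDigraph D′) ≥ k)
lemma9 (suc j) n _ D many with prune ⌊ j /2⌋ (adj D) dense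
  where
  dense : Dense ⌊ j /2⌋ (adj D)
  dense = Dense-many-arcs {c = ⌊ j /2⌋} (adj D) (⌊n/2⌋+⌊n/2⌋≤n j)
                          (subst (j * n <_) (edges≡size D) many)
... | G , G⊆D , 0<size , bounded =
  spanning D G G⊆D ,
  ≤-trans (n≤2*⌈n/2⌉ (suc j)) (*-monoʳ-≤ 2 (minPseudoSemidegree-spanning D G G⊆D bounded 0<size))
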